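{- There is a satisfiable HyperLTL sentence that is not satisfied by any $\omega$-context-free set of traces.
   Context: Fix a finite set $AP$ of atomic propositions. A trace over $AP$ is a map $t:\mathbb{N}\to 2^{AP}$, i.e., an infinite word over the alphabet $2^{AP}$; a set of traces is $\omega$-context-free if it is an $\omega$-context-free language over $2^{AP}$ (in the sense of Cohen and Gold, i.e., accepted by a Büchi pushdown automaton). HyperLTL formulas are given by the grammar $\varphi ::= \exists \pi.\ \varphi \mid \forall \pi.\ \varphi \mid \psi$ and $\psi ::= a_\pi \mid \neg\psi \mid \psi\vee\psi \mid \mathbf{X}\psi \mid \psi\,\mathbf{U}\,\psi$, where $a\in AP$ and $\pi$ ranges over a countable set of trace variables. For a set $T$ of traces and a trace assignment $\Pi$ (a partial map from trace variables to traces), with $\Pi[j]$ denoting the assignment mapping each $\pi$ in the domain of $\Pi$ to the suffix $\Pi(\pi)(j)\Pi(\pi)(j+1)\cdots$: $(T,\Pi)\models a_\pi$ iff $a\in\Pi(\pi)(0)$; negation and disjunction are as usual; $(T,\Pi)\models\mathbf{X}\psi$ iff $(T,\Pi[1])\models\psi$; $(T,\Pi)\models\psi_1\mathbf{U}\psi_2$ iff there is $j\ge 0$ with $(T,\Pi[j])\models\psi_2$ and $(T,\Pi[j'])\models\psi_1$ for all $0\le j'<j$; $(T,\Pi)\models\exists\pi.\varphi$ iff there is $t\in T$ with $(T,\Pi[\pi\mapsto t])\models\varphi$; $(T,\Pi)\models\forall\pi.\varphi$ iff this holds for all $t\in T$. A sentence is a formula without free trace variables; $T$ satisfies (is a model of)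 a sentence $\varphi$ if $(T,\Pi_\emptyset)\models\varphi$ for the empty assignment $\Pi_\emptyset$. A sentence is satisfiable if it has a model. -}

module Defs where

open import Data.Nat using (ℕ; zero; suc; _+_; _≤_; _<_)
open import Data.Fin using (Fin; zero; suc)
open import Data.Bool using (Bool; true)
open import Data.Maybe using (Maybe; nothing; just)
open import Data.List using (List; []; _∷_; _++_)
open import Data.List.Membership.Propositional using (_∈_)
open import Data.Product using (Σ; ∃; _×_; _,_)
open import Data.Sum using (_⊎_)
open import Relation.Nullary using (¬_)
open import Relation.Binary.PropositionalEquality using (_≡_)

-- Atomic propositions: AP = Fin n.  Letters are subsets of AP, i.e.
-- elements of 2^AP, represented as characteristic functions.

Letter : ℕ → Set
Letter n = Fin n → Bool

Trace : ℕ → Set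
Trace n = ℕ → Letter n

TraceSet : ℕ → Set₁
TraceSet n = Trace n → Set

-- HyperLTL syntax, with trace variables in de Bruijn style:
-- a formula of scope k may refer to k bound trace variables (Fin k);
-- the most recently bound variable is index zero.

data Body (n k : ℕ) : Set where
  atom : Fin n → Fin k → Body n k
  neg  : Body n k → Body n k
  or   : Body n k → Body n k → Body n k
  next : Body n k → Body n k
  until : Body n k → Body n k → Body n k

data Formula (n k : ℕ) : Set where
  exists : Formula n (suc k) → Formula n k
  all : Formula n (suc k) → Formula n k
  body   : Body n k → Formula n k

Sentence : ℕ → Set
Sentence n = Formula n 0

Assignment : ℕ → ℕ → Set
Assignment n k = Fin k → Trace n

extend : ∀ {n k} → Trace n → Assignment n k → Assignment n (suc k)
extend t Π zero = t
extend t Π (suc x) = Π x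

shift : ∀ {n k} → ℕ → Assignment n k → Assignment n k
shift j Π x = λ m → Π x (j + m)

_⊨ᵇ_ : ∀ {n k} → Assignment n k → Body n k → Set
Π ⊨ᵇ atom a x = Π x 0 a ≡ true
Π ⊨ᵇ neg ψ = ¬ (Π ⊨ᵇ ψ)
Π ⊨ᵇ or ψ₁ ψ₂ = (Π ⊨ᵇ ψ₁) ⊎ (Π ⊨ᵇ ψ₂)
Π ⊨ᵇ next ψ = shift 1 Π ⊨ᵇ ψ
Π ⊨ᵇ until ψ₁ ψ₂ =
  Σ ℕ λ j → (shift j Π ⊨ᵇ ψ₂) × (∀ j' → j' < j → shift j' Π ⊨ᵇ ψ₁)

Models : ∀ {n k} → TraceSet n → Assignment n k → Formula n k → Set
Models T Π (exists φ) = Σ (Trace _) λ t → T t × Models T (extend t Π) φ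
Models T Π (all φ) = ∀ t → T t → Models T (extend t Π) φ
Models T Π (body ψ) = Π ⊨ᵇ ψ

emptyAssignment : ∀ {n} → Assignment n 0
emptyAssignment ()

_⊨_ : ∀ {n} → TraceSet n → Sentence n → Set
T ⊨ φ = Models T emptyAssignment φ

Satisfiable : ∀ {n} → Sentence n → Set₁
Satisfiable {n} φ = Σ (TraceSet n) λ T → T ⊨ φ

-- Büchi pushdown automata (with ε-moves) over an alphabet A.
-- A transition (q , a , γ , q' , β) : in state q with top of stack γ,
-- reading a (or ε when a = nothing), go to q' and replace γ by β.

record BPDA (A : Set) : Set where
  field
    nQ nΓ : ℕ
    q₀ : Fin nQ
    Z₀ : Fin nΓ
    Δ  : List (Fin nQ × Maybe A × Fin nΓ × Fin nQ × List (Fin nΓ))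
    F  : Fin nQ → Bool

module _ {A : Set} (P : BPDA A) where
  open BPDA P

  -- An accepting run on the infinite word w: a sequence of
  -- configurations (state, stack) with the number of letters consumed
  -- so far; every step applies a transition; the whole word is read;
  -- an accepting state occurs infinitely often.
  record AcceptingRun (w : ℕ → A) : Set where
    field
      st  : ℕ → Fin nQ
      stk : ℕ → List (Fin nΓ)
      pos : ℕ → ℕ
      st-init  : st 0 ≡ q₀
      stk-init : stk 0 ≡ Z₀ ∷ []
      pos-init : pos 0 ≡ 0
      step : ∀ i → Σ (Fin nΓ) λ γ → Σ (List (Fin nΓ)) λ s → Σ (List (Fin nΓ)) λ β →
               (stk i ≡ γ ∷ s) × (stk (suc i) ≡ β ++ s) ×
               ((pos (suc i) ≡ pos i × (st i , nothing , γ , st (suc i) , β) ∈ Δ)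
                ⊎ (pos (suc i) ≡ suc (pos i) × (st i , just (w (pos i)) , γ , st (suc i) , β) ∈ Δ))
      progress : ∀ k → Σ ℕ λ i → k ≤ pos i
      buchi : ∀ i → Σ ℕ λ j → i ≤ j × F (st j) ≡ true

  Accepts : (ℕ → A) → Set
  Accepts w = AcceptingRun w

OmegaContextFree : ∀ {n} → TraceSet n → Set
OmegaContextFree {n} T =
  Σ (BPDA (Letter n)) λ P → ∀ t → (T t → Accepts P t) × (Accepts P t → T t)

module Submission where

-- The sentence ∃w ∀π ∃π′ makes w carry a at 1, never at odd positions ≥ 3,
-- and, through a chain of successor traces marking n with b and 2n with c,
-- at n exactly when at 2n; so a occurs at every power of two but at no
-- 1 + 2L.  If the model were ω-context-free, pumping down the run on w would
-- delete an infix w[p, p + L) with p ≥ 1 and L ≥ 1 and stay in the model;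
-- the result still carries b at 0 and hence agrees with w on a, so a would be
-- L-periodic from p on, giving a(2ᵖ) = a(2ᵖ(1 + 2L)) = a(1 + 2L).

open import Defs
open import Data.Bool using (Bool; true; false; not; if_then_else_; T)
open import Data.Bool.Properties using (¬-not) renaming (_≟_ to _≟ᵇ_)
open import Data.Empty using (⊥)
open import Data.Fin using (Fin; zero; suc; combine)
open import Data.Fin.Properties using (combine-injective)
open import Data.List using (List; []; _∷_; _++_; length)
open import Data.List.Membership.Propositional using (_∈_)
open import Data.List.Properties using (++-assoc; ++-cancelʳ; ∷-injectiveʳ)
open import Data.List.Relation.Unary.All using (All; []; _∷_)
open import Data.Maybe using (nothing; just)
open import Data.Nat
open import Data.Nat.InfinitelyOften using (Inf; commutes-with-∪; up; witness) renaming (map to Inf-map)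
open import Data.Nat.Properties
open import Data.Nat.Tactic.RingSolver using (solve-∀)
open import Data.Product using (Σ; ∃; ∃₂; _×_; _,_; proj₁; proj₂)
import Data.Product as Product
open import Data.Sum using (_⊎_; inj₁; inj₂; [_,_]′)
import Data.Sum as Sum
open import Effect.Monad using (RawMonad)
open import Function using (_∘_)
open import Function.Bundles using (mk⇔)
open import Level using (0ℓ)
open import Relation.Nullary using (¬_; Dec; does; yes; no)
open import Relation.Nullary.Decidable using (decidable-stable; map′; dec-true; dec-false; does-⇔)
open import Relation.Nullary.Negation using (¬¬-Monad; contradiction)
open import Relation.Unary using (_∪_)
open import Relation.Binary.PropositionalEquality

open RawMonad (¬¬-Monad {0ℓ})

≡-stable : {x y : Bool} → ¬ ¬ x ≡ y → x ≡ y
≡-stable {x} {y} = decidable-stable (x ≟ᵇ y)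

≡-from-⇔ : {x y : Bool} → (x ≡ true → ¬ ¬ y ≡ true) → (y ≡ true → ¬ ¬ x ≡ true) → x ≡ y
≡-from-⇔ {false} {false} _ _ = refl
≡-from-⇔ {false} {true} _ g = contradiction (λ ()) (g refl)
≡-from-⇔ {true} {false} f _ = contradiction (λ ()) (f refl)
≡-from-⇔ {true} {true} _ _ = refl

≡ᵇ-refl : ∀ m → (m ≡ᵇ m) ≡ true
≡ᵇ-refl zero = refl
≡ᵇ-refl (suc m) = ≡ᵇ-refl m

≡ᵇ-sound : ∀ {m n} → (m ≡ᵇ n) ≡ true → m ≡ n
≡ᵇ-sound {m} {n} eq = ≡ᵇ⇒≡ m n (subst T (sym eq) _)


-- Pumping down Büchi pushdown automata

splice : {X : Set} → ℕ → (ℕ → X) → (ℕ → X) → ℕ → X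
splice i f g k = if k <ᵇ i then f k else g (k ∸ i)

splice-< : ∀ {X : Set} i (f g : ℕ → X) {k} → k < i → splice i f g k ≡ f k
splice-< i f g {k} k<i with k <ᵇ i | <⇒<ᵇ k<i
... | true | _ = refl

splice-+ : ∀ {X : Set} i (f g : ℕ → X) e → splice i f g (e + i) ≡ g e
splice-+ i f g e with e + i <ᵇ i in e+i<ᵇi
... | false = cong g (m+n∸n≡m e i)
... | true = contradiction (<ᵇ⇒< (e + i) i (subst T (sym e+i<ᵇi) _)) (≤⇒≯ (m≤n+m i e))

splice-≤ : ∀ {X : Set} i (f g : ℕ → X) → f i ≡ g 0 → ∀ {k} → k ≤ i → splice i f g k ≡ f k
splice-≤ i f g fi≡g0 k≤i with m≤n⇒m<n∨m≡n k≤i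
... | inj₁ k<i = splice-< i f g k<i
... | inj₂ refl = trans (splice-+ i f g 0) (sym fi≡g0)

delete : {A : Set} → (ℕ → A) → ℕ → ℕ → ℕ → A
delete w p L = splice p w (λ e → w (e + p + L))

delete-< : ∀ {A : Set} (w : ℕ → A) {p L t} → t < p → delete w p L t ≡ w t
delete-< w {p} {L} = splice-< p w (λ e → w (e + p + L))

delete-≥ : ∀ {A : Set} (w : ℕ → A) {p L t} → p ≤ t → delete w p L t ≡ w (t + L)
delete-≥ w {p} {L} {t} p≤t = begin
  delete w p L t                 ≡⟨ cong (delete w p L) (sym (m∸n+n≡m p≤t)) ⟩
  delete w p L (t ∸ p + p)       ≡⟨ splice-+ p w (λ e → w (e + p + L)) (t ∸ p) ⟩
  w (t ∸ p + p + L)              ≡⟨ cong (λ m → w (m + L)) (m∸n+n≡m p≤t) ⟩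
  w (t + L)                      ∎
  where open ≡-Reasoning

SuffixMinimum : (ℕ → ℕ) → ℕ → Set
SuffixMinimum f i = ∀ k → i ≤ k → f i ≤ f k

suffix-minima-inf : (f : ℕ → ℕ) → Inf (SuffixMinimum f)
suffix-minima-inf f (N , none-after-N) = descend (f N) N ≤-refl ≤-refl
  where
  smaller-later : ∀ i → ¬ SuffixMinimum f i → ¬ ¬ ∃ λ k → i ≤ k × f k < f i
  smaller-later i ¬min ¬smaller = ¬min λ k i≤k → ≮⇒≥ λ fk<fi → ¬smaller (k , i≤k , fk<fi)
  descend : ∀ v i → N ≤ i → f i ≤ v → ⊥
  descend zero i N≤i fi≤0 = smaller-later i (none-after-N i N≤i) λ (_ , _ , fk<fi) →
    n≮0 (<-≤-trans fk<fi fi≤0)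
  descend (suc v) i N≤i fi≤v = smaller-later i (none-after-N i N≤i) λ (k , i≤k , fk<fi) →
    descend v k (≤-trans N≤i i≤k) (≤-pred (≤-trans fk<fi fi≤v))

Inf-pigeonhole : ∀ {m} {P : ℕ → Set} {Q : Fin m → ℕ → Set} →
                 (∀ i → P i → ∃ λ c → Q c i) → Inf P → ¬ ¬ ∃ λ c → Inf (Q c)
Inf-pigeonhole {zero} cover inf = do
  i , Pi ← witness inf
  contradiction (proj₁ (cover i Pi)) λ ()
Inf-pigeonhole {suc m} {P} {Q} cover inf =
  commutes-with-∪ (Inf-map split inf) >>= [ (λ inf₀ → pure (zero , inf₀)) , (λ inf₊ → do
    c , inf-c ← Inf-pigeonhole (λ _ Qc → Qc) inf₊
    pure (suc c , inf-c)) ]′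
  where
  split : ∀ {i} → P i → (Q zero ∪ (λ i → ∃ λ c → Q (suc c) i)) i
  split {i} Pi with cover i Pi
  ... | zero , q = inj₁ q
  ... | suc c , q = inj₂ (c , q)

rebase : ∀ {X : Set} {γ γ′ x : X} {α α′ s β Y Z : List X} →
         γ ∷ α ++ Y ≡ x ∷ s → γ′ ∷ α′ ++ Y ≡ β ++ s →
         ∃ λ s′ → γ ∷ α ++ Z ≡ x ∷ s′ × γ′ ∷ α′ ++ Z ≡ β ++ s′
rebase {γ′ = γ′} {α = α} {α′} {β = β} {Y} {Z} refl pushed =
  α ++ Z , refl , trans (cong (_++ Z) prefix) (++-assoc β α Z)
  where
  prefix : γ′ ∷ α′ ≡ β ++ α
  prefix = ++-cancelʳ Y (γ′ ∷ α′) (β ++ α) (trans pushed (sym (++-assoc β α Y)))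

module _ {A : Set} (P : BPDA A) where
  open BPDA P

  Step : (ℕ → A) → (ℕ → Fin nQ) → (ℕ → List (Fin nΓ)) → (ℕ → ℕ) → ℕ → Set
  Step w st stk pos i = Σ (Fin nΓ) λ γ → Σ (List (Fin nΓ)) λ s → Σ (List (Fin nΓ)) λ β →
    (stk i ≡ γ ∷ s) × (stk (suc i) ≡ β ++ s) ×
    ((pos (suc i) ≡ pos i × (st i , nothing , γ , st (suc i) , β) ∈ Δ)
     ⊎ (pos (suc i) ≡ suc (pos i) × (st i , just (w (pos i)) , γ , st (suc i) , β) ∈ Δ))

  module Run {w : ℕ → A} (r : AcceptingRun P w) where
    open AcceptingRun r

    top : ℕ → Fin nΓ
    top k = proj₁ (step k)

    rest : ℕ → List (Fin nΓ)
    rest k = proj₁ (proj₂ (step k))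

    stk≡top∷rest : ∀ k → stk k ≡ top k ∷ rest k
    stk≡top∷rest k = proj₁ (proj₂ (proj₂ (proj₂ (step k))))

    pos-suc : ∀ k → pos k ≤ pos (suc k)
    pos-suc k with step k
    ... | _ , _ , _ , _ , _ , inj₁ (same , _) = ≤-reflexive (sym same)
    ... | _ , _ , _ , _ , _ , inj₂ (moved , _) = ≤-trans (n≤1+n _) (≤-reflexive (sym moved))

    pos-+ : ∀ d k → pos k ≤ pos (d + k)
    pos-+ zero k = ≤-refl
    pos-+ (suc d) k = ≤-trans (pos-+ d k) (pos-suc (d + k))

    pos-mono : ∀ {k k′} → k ≤ k′ → pos k ≤ pos k′
    pos-mono {k} k≤k′ = subst (λ l → pos k ≤ pos l) (m∸n+n≡m k≤k′) (pos-+ (_ ∸ k) k)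

    height : ℕ → ℕ
    height k = length (stk k)

    frame : ∀ {j} → SuffixMinimum height j → ∀ e → ∃₂ λ γ α → stk (e + j) ≡ γ ∷ α ++ rest j
    frame {j} _ zero = top j , [] , stk≡top∷rest j
    frame {j} min-j (suc e) with frame min-j e | step (e + j)
    ... | γ , α , framed | _ , s , β , popped , pushed , _ = nonempty (β ++ α) stk≡
      where
      stk≡ : stk (suc e + j) ≡ (β ++ α) ++ rest j
      stk≡ = trans pushed (trans (cong (β ++_) (∷-injectiveʳ (trans (sym popped) framed)))
                                 (sym (++-assoc β α (rest j))))
      nonempty : ∀ xs → stk (suc e + j) ≡ xs ++ rest j →
                 ∃₂ λ γ α → stk (suc e + j) ≡ γ ∷ α ++ rest j
      nonempty [] stk≡rest = contradiction
        (subst₂ _≤_ (cong length (stk≡top∷rest j)) (cong length stk≡rest)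
                    (min-j (suc e + j) (m≤n+m j (suc e))))
        (n≮n _)
      nonempty (x ∷ xs) stk≡x∷xs = x , xs , stk≡x∷xs

    relabel : ∀ {q q′ l l′ γ β q₁ q₁′} → q ≡ q₁ → l ≡ l′ → q′ ≡ q₁′ →
              (q , l , γ , q′ , β) ∈ Δ → (q₁ , l′ , γ , q₁′ , β) ∈ Δ
    relabel refl refl refl t = t

    transfer-step : ∀ {w′ st′ stk′ pos′} k m δ →
      st′ k ≡ st m → st′ (suc k) ≡ st (suc m) →
      (∀ {γ s β} → stk m ≡ γ ∷ s → stk (suc m) ≡ β ++ s →
         ∃ λ s′ → stk′ k ≡ γ ∷ s′ × stk′ (suc k) ≡ β ++ s′) →
      pos′ k + δ ≡ pos m → pos′ (suc k) + δ ≡ pos (suc m) →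
      (pos (suc m) ≡ suc (pos m) → w′ (pos′ k) ≡ w (pos m)) →
      Step w′ st′ stk′ pos′ k
    transfer-step k m δ st₀ st₁ stacks pos₀ pos₁ letter with step m
    ... | γ , s , β , popped , pushed , move with stacks popped pushed
    ...   | s′ , popped′ , pushed′ = γ , s′ , β , popped′ , pushed′ , Sum.map
      (λ (same , t) → +-cancelʳ-≡ δ _ _ (trans pos₁ (trans same (sym pos₀))) ,
                      relabel (sym st₀) refl (sym st₁) t)
      (λ (moved , t) → +-cancelʳ-≡ δ _ _ (trans pos₁ (trans moved (cong suc (sym pos₀)))) ,
                       relabel (sym st₀) (cong just (sym (letter moved))) (sym st₁) t)
      move

    -- Cut the run between configurations i and j, which agree in state and
    -- top symbol: as j is stack-minimal, the run after j never pops below its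
    -- top symbol, so it can be replayed on the stack of configuration i.
    module Splice {i j : ℕ} (min-j : SuffixMinimum height j)
                  (st≡ : st i ≡ st j) (top≡ : top i ≡ top j) (pos< : pos i < pos j) where

      L : ℕ
      L = pos j ∸ pos i

      w′ : ℕ → A
      w′ = delete w (pos i) L

      st-above : ℕ → Fin nQ
      st-above e = st (e + j)

      stk-above : ℕ → List (Fin nΓ)
      stk-above e = let γ , α , _ = frame min-j e in γ ∷ α ++ rest i

      pos-above : ℕ → ℕ
      pos-above e = pos (e + j) ∸ L

      st′ : ℕ → Fin nQ
      st′ = splice i st st-above

      stk′ : ℕ → List (Fin nΓ)
      stk′ = splice i stk stk-above

      pos′ : ℕ → ℕ
      pos′ = splice i pos pos-above

      st′-≤ : ∀ {k} → k ≤ i → st′ k ≡ st k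
      st′-≤ = splice-≤ i st st-above st≡

      stk′-≤ : ∀ {k} → k ≤ i → stk′ k ≡ stk k
      stk′-≤ = splice-≤ i stk stk-above (trans (stk≡top∷rest i) (cong (_∷ rest i) top≡))

      pos′-≤ : ∀ {k} → k ≤ i → pos′ k ≡ pos k
      pos′-≤ = splice-≤ i pos pos-above (sym (m∸[m∸n]≡n (<⇒≤ pos<)))

      L≤pos : ∀ e → L ≤ pos (e + j)
      L≤pos e = ≤-trans (m∸n≤m (pos j) (pos i)) (pos-mono (m≤n+m j e))

      pos′-+ : ∀ e → pos′ (e + i) + L ≡ pos (e + j)
      pos′-+ e = trans (cong (_+ L) (splice-+ i pos pos-above e)) (m∸n+n≡m (L≤pos e))

      low-step : ∀ {k} → k < i → Step w′ st′ stk′ pos′ k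
      low-step {k} k<i = transfer-step {w′} {st′} {stk′} {pos′} k k 0
        (st′-≤ (<⇒≤ k<i)) (st′-≤ k<i)
        (λ popped pushed → _ , trans (stk′-≤ (<⇒≤ k<i)) popped , trans (stk′-≤ k<i) pushed)
        (trans (+-identityʳ _) (pos′-≤ (<⇒≤ k<i))) (trans (+-identityʳ _) (pos′-≤ k<i))
        (λ moved → trans (cong w′ (pos′-≤ (<⇒≤ k<i)))
                         (delete-< w (subst (_≤ pos i) moved (pos-mono k<i))))

      high-step : ∀ e → Step w′ st′ stk′ pos′ (e + i)
      high-step e = transfer-step {w′} {st′} {stk′} {pos′} (e + i) (e + j) L
        (splice-+ i st st-above e) (splice-+ i st st-above (suc e))
        (λ popped pushed →
          let _ , _ , framed₀ = frame min-j e
              _ , _ , framed₁ = frame min-j (suc e)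
              s′ , popped′ , pushed′ = rebase {Y = rest j} {Z = rest i}
                                              (trans (sym framed₀) popped) (trans (sym framed₁) pushed)
          in s′ , trans (splice-+ i stk stk-above e) popped′ ,
                  trans (splice-+ i stk stk-above (suc e)) pushed′)
        (pos′-+ e) (pos′-+ (suc e))
        (λ _ → trans (cong w′ (splice-+ i pos pos-above e))
                     (trans (delete-≥ w (m+n≤o⇒m≤o∸n (pos i) p+L≤)) (cong w (m∸n+n≡m (L≤pos e)))))
        where
        p+L≤ : pos i + L ≤ pos (e + j)
        p+L≤ = subst (_≤ pos (e + j)) (sym (m+[n∸m]≡n (<⇒≤ pos<))) (pos-mono (m≤n+m j e))

      new-step : ∀ k → Step w′ st′ stk′ pos′ k
      new-step k with k <? i
      ... | yes k<i = low-step k<i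
      ... | no k≮i = subst (Step w′ st′ stk′ pos′) (m∸n+n≡m (≮⇒≥ k≮i)) (high-step (k ∸ i))

      new-progress : ∀ K → ∃ λ k → K ≤ pos′ k
      new-progress K with progress (K + pos j)
      ... | k , K+pos-j≤pos-k = k + i , subst (K ≤_) (sym (splice-+ i pos pos-above k))
        (m+n≤o⇒m≤o∸n K (≤-trans (+-monoʳ-≤ K (m∸n≤m (pos j) (pos i)))
                                 (≤-trans K+pos-j≤pos-k (pos-mono (m≤m+n k j)))))

      new-buchi : ∀ K → ∃ λ k → K ≤ k × F (st′ k) ≡ true
      new-buchi K with buchi (K + j)
      ... | k , K+j≤k , accepting = k ∸ j + i , ≤-trans (m+n≤o⇒m≤o∸n K K+j≤k) (m≤m+n (k ∸ j) i) ,
        trans (cong F (trans (splice-+ i st st-above (k ∸ j))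
                             (cong st (m∸n+n≡m (≤-trans (m≤n+m j K) K+j≤k)))))
              accepting

      new-run : AcceptingRun P w′
      new-run = record
        { st = st′ ; stk = stk′ ; pos = pos′
        ; st-init = trans (st′-≤ z≤n) st-init
        ; stk-init = trans (stk′-≤ z≤n) stk-init
        ; pos-init = trans (pos′-≤ z≤n) pos-init
        ; step = new-step
        ; progress = new-progress
        ; buchi = new-buchi
        }

    repeated-configuration : ∀ N → ¬ ¬ ∃₂ λ i j → SuffixMinimum height j ×
                               st i ≡ st j × top i ≡ top j × N ≤ pos i × pos i < pos j
    repeated-configuration N = do
      c , inf-c ← Inf-pigeonhole {Q = λ c e → SuffixMinimum height (K + e) × key (K + e) ≡ c}
                                 (λ e min-e → key (K + e) , min-e , refl)
                                 (up K (suffix-minima-inf height))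
      e₁ , _ , key₁ ← witness inf-c
      let K′ , beyond = progress (suc (pos (K + e₁)))
      e₂ , min₂ , key₂ ← witness (up K′ inf-c)
      let st≡ , top≡ = combine-injective _ _ _ _ (trans key₁ (sym key₂))
      pure (K + e₁ , K + (K′ + e₂) , min₂ , st≡ , top≡ ,
            ≤-trans N≤pos-K (pos-mono (m≤m+n K e₁)) ,
            <-≤-trans beyond (pos-mono (≤-trans (m≤m+n K′ e₂) (m≤n+m (K′ + e₂) K))))
      where
      K : ℕ
      K = proj₁ (progress N)
      N≤pos-K : N ≤ pos K
      N≤pos-K = proj₂ (progress N)
      key : ℕ → Fin (nQ * nΓ)
      key k = combine (st k) (top k)

pumping : ∀ {A} (P : BPDA A) {w} → Accepts P w → ∀ N →
          ¬ ¬ ∃₂ λ p L → N ≤ p × 1 ≤ L × Accepts P (delete w p L)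
pumping P r N = do
  i , j , min-j , st≡ , top≡ , N≤pos-i , pos< ← repeated-configuration N
  pure (_ , _ , N≤pos-i , m<n⇒0<n∸m pos< , Splice.new-run min-j st≡ top≡ pos<)
  where open Run P r

-- Positional semantics of bodies

Exactly : ∀ {n} → Trace n → Fin n → ℕ → Set
Exactly t q m = ∀ k → t k q ≡ (k ≡ᵇ m)

⟦_⟧ : ∀ {n k} → Body n k → Assignment n k → ℕ → Set
⟦ atom q x ⟧ Π i = Π x i q ≡ true
⟦ neg ψ ⟧ Π i = ¬ ⟦ ψ ⟧ Π i
⟦ or ψ χ ⟧ Π i = ⟦ ψ ⟧ Π i ⊎ ⟦ χ ⟧ Π i
⟦ next ψ ⟧ Π i = ⟦ ψ ⟧ Π (suc i)
⟦ until ψ χ ⟧ Π i = ∃ λ j → ⟦ χ ⟧ Π (i + j) × (∀ j′ → j′ < j → ⟦ ψ ⟧ Π (i + j′))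

⊨ᵇ⇔⟦⟧ : ∀ {n k} (ψ : Body n k) {Π Π′ : Assignment n k} i → (∀ x m → Π′ x m ≡ Π x (i + m)) →
         (Π′ ⊨ᵇ ψ → ⟦ ψ ⟧ Π i) × (⟦ ψ ⟧ Π i → Π′ ⊨ᵇ ψ)
⊨ᵇ⇔⟦⟧ (atom q x) {Π} {Π′} i Π′≗Π = (λ h → trans (sym same) h) , (λ h → trans same h)
  where
  same : Π′ x 0 q ≡ Π x i q
  same = cong (λ l → l q) (trans (Π′≗Π x 0) (cong (Π x) (+-identityʳ i)))
⊨ᵇ⇔⟦⟧ (neg ψ) i Π′≗Π =
  let to , from = ⊨ᵇ⇔⟦⟧ ψ i Π′≗Π in (λ h → h ∘ from) , (λ h → h ∘ to)
⊨ᵇ⇔⟦⟧ (or ψ χ) i Π′≗Π =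
  let ψ-to , ψ-from = ⊨ᵇ⇔⟦⟧ ψ i Π′≗Π ; χ-to , χ-from = ⊨ᵇ⇔⟦⟧ χ i Π′≗Π
  in Sum.map ψ-to χ-to , Sum.map ψ-from χ-from
⊨ᵇ⇔⟦⟧ (next ψ) {Π} i Π′≗Π =
  ⊨ᵇ⇔⟦⟧ ψ (suc i) λ x m → trans (Π′≗Π x (suc m)) (cong (Π x) (+-suc i m))
⊨ᵇ⇔⟦⟧ (until ψ χ) {Π} {Π′} i Π′≗Π =
  Product.map₂ (Product.map (proj₁ (at χ _)) λ h j′ j′<j → proj₁ (at ψ j′) (h j′ j′<j)) ,
  Product.map₂ (Product.map (proj₂ (at χ _)) λ h j′ j′<j → proj₂ (at ψ j′) (h j′ j′<j))
  where
  at : ∀ φ j → (shift j Π′ ⊨ᵇ φ → ⟦ φ ⟧ Π (i + j)) × (⟦ φ ⟧ Π (i + j) → shift j Π′ ⊨ᵇ φ)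
  at φ j = ⊨ᵇ⇔⟦⟧ φ (i + j) λ x m → trans (Π′≗Π x (j + m)) (cong (Π x) (sym (+-assoc i j m)))

-- ⟦_⟧ is not injective, so Agda could not recover ψ from ⟦ ψ ⟧ Π i; the
-- record wrapper keeps Π, i and ψ inferable in the rules below.
record Holds {n k} (Π : Assignment n k) (i : ℕ) (ψ : Body n k) : Set where
  constructor ⟨_⟩
  field holds : ⟦ ψ ⟧ Π i
open Holds public

⊨ᵇ⇒Holds : ∀ {n k} {Π : Assignment n k} (ψ : Body n k) → Π ⊨ᵇ ψ → Holds Π 0 ψ
⊨ᵇ⇒Holds ψ h = ⟨ proj₁ (⊨ᵇ⇔⟦⟧ ψ 0 (λ _ _ → refl)) h ⟩

Holds⇒⊨ᵇ : ∀ {n k} {Π : Assignment n k} (ψ : Body n k) → Holds Π 0 ψ → Π ⊨ᵇ ψ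
Holds⇒⊨ᵇ ψ ⟨ h ⟩ = proj₂ (⊨ᵇ⇔⟦⟧ ψ 0 (λ _ _ → refl)) h

module _ {n k : ℕ} where

  infixr 6 _∧_
  infixr 5 _⇒_ _⇔_

  -- Conjunction and implication are taken in negative form so that their
  -- introduction rules hold constructively.
  _∧_ _⇒_ _⇔_ : Body n k → Body n k → Body n k
  ψ ∧ χ = neg (or (neg ψ) (neg χ))
  ψ ⇒ χ = neg (ψ ∧ neg χ)
  ψ ⇔ χ = (ψ ⇒ χ) ∧ (χ ⇒ ψ)

  module _ {Π : Assignment n k} {i : ℕ} where

    neg-intro : ∀ {ψ} → ¬ Holds Π i ψ → Holds Π i (neg ψ)
    neg-intro ¬h = ⟨ (λ h → ¬h ⟨ h ⟩) ⟩

    neg-elim : ∀ {ψ} → Holds Π i (neg ψ) → ¬ Holds Π i ψ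
    neg-elim ⟨ ¬h ⟩ ⟨ h ⟩ = ¬h h

    next-intro : ∀ {ψ} → Holds Π (suc i) ψ → Holds Π i (next ψ)
    next-intro ⟨ h ⟩ = ⟨ h ⟩

    next-elim : ∀ {ψ} → Holds Π i (next ψ) → Holds Π (suc i) ψ
    next-elim ⟨ h ⟩ = ⟨ h ⟩

    atom-stable : ∀ {q x} → ¬ ¬ Holds Π i (atom q x) → Holds Π i (atom q x)
    atom-stable ¬¬h = ⟨ ≡-stable (λ ¬h → ¬¬h λ h → ¬h (holds h)) ⟩

    ∧-intro : ∀ {ψ χ} → Holds Π i ψ → Holds Π i χ → Holds Π i (ψ ∧ χ)
    ∧-intro ⟨ a ⟩ ⟨ b ⟩ = ⟨ [ (λ ¬a → ¬a a) , (λ ¬b → ¬b b) ]′ ⟩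

    ∧-elim : ∀ {ψ χ} → Holds Π i (ψ ∧ χ) → ¬ ¬ (Holds Π i ψ × Holds Π i χ)
    ∧-elim ⟨ h ⟩ ¬ab = h (inj₁ λ a → h (inj₂ λ b → ¬ab (⟨ a ⟩ , ⟨ b ⟩)))

    ⇒-intro : ∀ {ψ χ} → (Holds Π i ψ → Holds Π i χ) → Holds Π i (ψ ⇒ χ)
    ⇒-intro f = ⟨ (λ k → k (inj₁ λ a → k (inj₂ λ ¬b → ¬b (holds (f ⟨ a ⟩))))) ⟩

    ⇒-elim : ∀ {ψ χ} → Holds Π i (ψ ⇒ χ) → ¬ ¬ (Holds Π i ψ → Holds Π i χ)
    ⇒-elim ⟨ h ⟩ ¬f = h [ (λ ¬a → ¬f λ a → contradiction (holds a) ¬a)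
                        , (λ ¬¬b → ¬¬b λ b → ¬f λ _ → ⟨ b ⟩) ]′

    ⇔-intro : ∀ {ψ χ} → (Holds Π i ψ → Holds Π i χ) → (Holds Π i χ → Holds Π i ψ) →
              Holds Π i (ψ ⇔ χ)
    ⇔-intro f g = ∧-intro (⇒-intro f) (⇒-intro g)

    ⇔-elim : ∀ {ψ χ} → Holds Π i (ψ ⇔ χ) →
             ¬ ¬ ((Holds Π i ψ → Holds Π i χ) × (Holds Π i χ → Holds Π i ψ))
    ⇔-elim h = do
      f , g ← ∧-elim h
      f′ ← ⇒-elim f
      g′ ← ⇒-elim g
      pure (f′ , g′)

module _ {n k : ℕ} where

  -- Bodies have no constants: ⊤ is excluded middle on an arbitrary atom.  Being
  -- or-headed, unlike _∧_, it also lets Agda recover ψs from ⋀ ψs.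
  ⊤ : Body (suc n) (suc k)
  ⊤ = or (atom zero zero) (neg (atom zero zero))

  ◇_ □_ : Body (suc n) (suc k) → Body (suc n) (suc k)
  ◇ ψ = until ⊤ ψ
  □ ψ = neg (◇ neg ψ)

  ⋀ : List (Body (suc n) (suc k)) → Body (suc n) (suc k)
  ⋀ [] = ⊤
  ⋀ (ψ ∷ ψs) = ψ ∧ ⋀ ψs

  ⊤-intro : ∀ {Π : Assignment (suc n) (suc k)} {i} → Holds Π i ⊤
  ⊤-intro {Π} {i} with Π zero i zero in eq
  ... | true = ⟨ inj₁ eq ⟩
  ... | false = ⟨ inj₂ (λ e → contradiction (trans (sym e) eq) λ ()) ⟩

  module _ {Π : Assignment (suc n) (suc k)} {i : ℕ} where

    ◇-intro : ∀ {ψ} j → Holds Π (i + j) ψ → Holds Π i (◇ ψ)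
    ◇-intro j ⟨ h ⟩ = ⟨ j , h , (λ j′ _ → holds (⊤-intro {Π = Π} {i + j′})) ⟩

    ◇-elim : ∀ {ψ} → Holds Π i (◇ ψ) → ∃ λ j → Holds Π (i + j) ψ
    ◇-elim ⟨ j , h , _ ⟩ = j , ⟨ h ⟩

    □-intro : ∀ {ψ} → (∀ j → Holds Π (i + j) ψ) → Holds Π i (□ ψ)
    □-intro h = neg-intro λ ◇¬ψ → let j , ¬h = ◇-elim ◇¬ψ in neg-elim ¬h (h j)

    □-elim : ∀ {ψ} → Holds Π i (□ ψ) → ∀ j → ¬ ¬ Holds Π (i + j) ψ
    □-elim h j ¬h = neg-elim h (◇-intro j (neg-intro ¬h))

  module _ {Π : Assignment (suc n) (suc k)} {i : ℕ} where

    ⋀-intro : ∀ {ψs} → All (Holds Π i) ψs → Holds Π i (⋀ ψs)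
    ⋀-intro [] = ⊤-intro
    ⋀-intro (h ∷ hs) = ∧-intro h (⋀-intro hs)

    ⋀-elim : ∀ {ψs} → Holds Π i (⋀ ψs) → ¬ ¬ All (Holds Π i) ψs
    ⋀-elim {[]} _ = pure []
    ⋀-elim {_ ∷ _} h = do
      h₁ , hs ← ∧-elim h
      hs′ ← ⋀-elim hs
      pure (h₁ ∷ hs′)

  ◇-exactly-elim : ∀ {Π : Assignment (suc n) (suc k)} {q x m ψ} → Exactly (Π x) q m →
                   Holds Π 0 (◇ (atom q x ∧ ψ)) → ¬ ¬ Holds Π m ψ
  ◇-exactly-elim {Π} {ψ = ψ} only h = do
    let j , q∧ψ = ◇-elim h
    ⟨ q-at-j ⟩ , ψ-at-j ← ∧-elim q∧ψ
    pure (subst (λ l → Holds Π l ψ) (≡ᵇ-sound (trans (sym (only j)) q-at-j)) ψ-at-j)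

  ◇-exactly-intro : ∀ {Π : Assignment (suc n) (suc k)} {q x m ψ} → Exactly (Π x) q m →
                    Holds Π m ψ → Holds Π 0 (◇ (atom q x ∧ ψ))
  ◇-exactly-intro {m = m} only h = ◇-intro m (∧-intro ⟨ trans (only m) (≡ᵇ-refl m) ⟩ h)

-- The sentence

a o b c : Fin 4
a = zero
o = suc zero
b = suc (suc zero)
c = suc (suc (suc zero))

infix 10 _⟨π′⟩ _⟨π⟩ _⟨w⟩

-- Variables in de Bruijn order: the sentence is ∃ w ∀ π ∃ π′.
_⟨π′⟩ _⟨π⟩ _⟨w⟩ : Fin 4 → Body 4 3
q ⟨π′⟩ = atom q zero
q ⟨π⟩ = atom q (suc zero)
q ⟨w⟩ = atom q (suc (suc zero))

a-at-1 o-alternates a-not-at-odd bc-only-at-0 doubling successor agreement : Body 4 3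
a-at-1 = next (a ⟨w⟩)
o-alternates = neg (o ⟨w⟩) ∧ □ (o ⟨w⟩ ⇔ next (neg (o ⟨w⟩)))
a-not-at-odd = next (next (□ (o ⟨w⟩ ⇒ neg (a ⟨w⟩))))
bc-only-at-0 = ⋀ (b ⟨w⟩ ∷ c ⟨w⟩ ∷ next (□ (neg (b ⟨w⟩) ∧ neg (c ⟨w⟩))) ∷ [])
doubling = ◇ (b ⟨π⟩ ∧ a ⟨w⟩) ⇔ ◇ (c ⟨π⟩ ∧ a ⟨w⟩)
successor = ⋀ (neg (b ⟨π′⟩) ∷ neg (c ⟨π′⟩) ∷ next (neg (c ⟨π′⟩)) ∷
               □ (b ⟨π⟩ ⇔ next (b ⟨π′⟩)) ∷ □ (c ⟨π⟩ ⇔ next (next (c ⟨π′⟩))) ∷ [])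
agreement = b ⟨π⟩ ⇒ □ (a ⟨π⟩ ⇔ a ⟨w⟩)

clauses : List (Body 4 3)
clauses = a-at-1 ∷ o-alternates ∷ a-not-at-odd ∷ bc-only-at-0 ∷ doubling ∷ successor ∷ agreement ∷ []

φ : Sentence 4
φ = exists (all (exists (body (⋀ clauses))))

assign : Trace 4 → Trace 4 → Trace 4 → Assignment 4 3
assign π′ π w = extend π′ (extend π (extend w emptyAssignment))


-- A model

odd : ℕ → Bool
odd zero = false
odd (suc n) = not (odd n)

odd-*2 : ∀ n → odd (n * 2) ≡ false
odd-*2 zero = refl
odd-*2 (suc n) rewrite odd-*2 n = refl

odd-2^suc : ∀ e → odd (2 ^ suc e) ≡ false
odd-2^suc e = trans (cong odd (*-comm 2 (2 ^ e))) (odd-*2 (2 ^ e))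

n<2^n : ∀ n → n < 2 ^ n
n<2^n zero = s≤s z≤n
n<2^n (suc n) = +-mono-≤ (m^n>0 2 n) (≤-trans (n<2^n n) (m≤m+n (2 ^ n) 0))

IsPowerOf2 : ℕ → Set
IsPowerOf2 m = ∃ λ e → 2 ^ e ≡ m

isPowerOf2? : ∀ m → Dec (IsPowerOf2 m)
isPowerOf2? m = map′ (λ (e , _ , 2^e≡m) → e , 2^e≡m)
                     (λ (e , 2^e≡m) → e , m<n⇒m<1+n (subst (e <_) 2^e≡m (n<2^n e)) , 2^e≡m)
                     (anyUpTo? (λ e → 2 ^ e ≟ m) (suc m))

isPow2 : ℕ → Bool
isPow2 = does ∘ isPowerOf2?

isPow2-*2 : ∀ m → isPow2 (m * 2) ≡ isPow2 m
isPow2-*2 m = does-⇔ (mk⇔ halve double) (isPowerOf2? (m * 2)) (isPowerOf2? m)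
  where
  halve : IsPowerOf2 (m * 2) → IsPowerOf2 m
  halve (zero , 1≡2m) = contradiction (trans (cong odd 1≡2m) (odd-*2 m)) λ ()
  halve (suc e , 2^e+1≡2m) = e , *-cancelʳ-≡ (2 ^ e) m 2 (trans (*-comm (2 ^ e) 2) 2^e+1≡2m)
  double : IsPowerOf2 m → IsPowerOf2 (m * 2)
  double (e , 2^e≡m) = suc e , trans (*-comm 2 (2 ^ e)) (cong (_* 2) 2^e≡m)

isPow2-odd : ∀ m → odd (2 + m) ≡ true → isPow2 (2 + m) ≡ false
isPow2-odd m odd-m = dec-false (isPowerOf2? (2 + m)) λ
  { (suc e , 2^e+1≡2+m) →
      contradiction (trans (sym odd-m) (trans (cong odd (sym 2^e+1≡2+m)) (odd-2^suc e))) λ () }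

trace : (ℕ → Bool) → (ℕ → Bool) → ℕ → Trace 4
trace α ω n k zero = α k
trace α ω n k (suc zero) = ω k
trace α ω n k (suc (suc zero)) = k ≡ᵇ n
trace α ω n k (suc (suc (suc zero))) = k ≡ᵇ n * 2

W : Trace 4
W = trace isPow2 odd 0

blank : ℕ → Trace 4
blank = trace (λ _ → false) (λ _ → false)

-- blank 0 is left out: it carries b at 0 without agreeing with W on a.
model : TraceSet 4
model t = t ≡ W ⊎ ∃ λ n → t ≡ blank (suc n)

module _ {π′ π : Trace 4} where

  W-a-at-1 : Holds (assign π′ π W) 0 a-at-1
  W-a-at-1 = ⟨ dec-true (isPowerOf2? 1) (0 , refl) ⟩

  W-o-alternates : Holds (assign π′ π W) 0 o-alternates
  W-o-alternates = ∧-intro ⟨ (λ ()) ⟩ (□-intro λ j → ⇔-intro (λ { ⟨ o-j ⟩ → ⟨ alternate o-j ⟩ })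
                                                            (λ { ⟨ ¬o-j+1 ⟩ → ⟨ alternate⁻¹ ¬o-j+1 ⟩ }))
    where
    alternate : ∀ {x} → x ≡ true → ¬ not x ≡ true
    alternate refl ()
    alternate⁻¹ : ∀ {x} → ¬ not x ≡ true → x ≡ true
    alternate⁻¹ {true} _ = refl
    alternate⁻¹ {false} h = contradiction refl h

  W-a-not-at-odd : Holds (assign π′ π W) 0 a-not-at-odd
  W-a-not-at-odd = next-intro (next-intro (□-intro λ j → ⇒-intro λ { ⟨ odd-j ⟩ →
    ⟨ (λ a-j → contradiction (trans (sym a-j) (isPow2-odd j odd-j)) λ ()) ⟩ }))

  W-bc-only-at-0 : Holds (assign π′ π W) 0 bc-only-at-0
  W-bc-only-at-0 =
    ⋀-intro (⟨ refl ⟩ ∷ ⟨ refl ⟩ ∷ next-intro (□-intro λ _ → ∧-intro ⟨ (λ ()) ⟩ ⟨ (λ ()) ⟩) ∷ [])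

module _ (α ω : ℕ → Bool) (n : ℕ) where

  private
    Π : Assignment 4 3
    Π = assign (blank (suc n)) (trace α ω n) W

  doubling-holds : Holds Π 0 doubling
  doubling-holds = ⇔-intro
    (λ h → ◇-exactly-intro (λ _ → refl)
             ⟨ trans (isPow2-*2 n) (holds (atom-stable (◇-exactly-elim (λ _ → refl) h))) ⟩)
    (λ h → ◇-exactly-intro (λ _ → refl)
             ⟨ trans (sym (isPow2-*2 n)) (holds (atom-stable (◇-exactly-elim (λ _ → refl) h))) ⟩)

  successor-holds : Holds Π 0 successor
  successor-holds = ⋀-intro (⟨ (λ ()) ⟩ ∷ ⟨ (λ ()) ⟩ ∷ next-intro ⟨ (λ ()) ⟩ ∷
    □-intro (λ _ → ⇔-intro (λ { ⟨ e ⟩ → ⟨ e ⟩ }) (λ { ⟨ e ⟩ → ⟨ e ⟩ })) ∷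
    □-intro (λ _ → ⇔-intro (λ { ⟨ e ⟩ → ⟨ e ⟩ }) (λ { ⟨ e ⟩ → ⟨ e ⟩ })) ∷ [])

  clauses-hold : Holds Π 0 agreement → All (Holds Π 0) clauses
  clauses-hold agree = W-a-at-1 ∷ W-o-alternates ∷ W-a-not-at-odd ∷ W-bc-only-at-0 ∷
                       doubling-holds ∷ successor-holds ∷ agree ∷ []

model-closed : ∀ {π} → model π → ∃ λ π′ → model π′ × Holds (assign π′ π W) 0 (⋀ clauses)
model-closed (inj₁ refl) = blank 1 , inj₂ (0 , refl) ,
  ⋀-intro (clauses-hold isPow2 odd 0
    (⇒-intro λ _ → □-intro λ _ → ⇔-intro (λ { ⟨ e ⟩ → ⟨ e ⟩ }) (λ { ⟨ e ⟩ → ⟨ e ⟩ })))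
model-closed (inj₂ (n , refl)) = blank (suc (suc n)) , inj₂ (suc n , refl) ,
  ⋀-intro (clauses-hold _ _ (suc n) (⇒-intro λ { ⟨ () ⟩ }))

φ-satisfiable : Satisfiable φ
φ-satisfiable = model , W , inj₁ refl , λ π π∈model →
  let π′ , π′∈model , h = model-closed π∈model in π′ , π′∈model , Holds⇒⊨ᵇ (⋀ clauses) h

-- No ω-context-free model

module Refutation (T : TraceSet 4) (w : Trace 4) (T-w : T w)
                  (closed : ∀ π → T π → ∃ λ π′ → T π′ × assign π′ π w ⊨ᵇ ⋀ clauses) where

  private
    A : ℕ → Bool
    A k = w k a

  next-of : ∀ π → T π → Trace 4
  next-of π T-π = proj₁ (closed π T-π)

  clauses-at : ∀ π (T-π : T π) → ¬ ¬ All (Holds (assign (next-of π T-π) π w) 0) clauses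
  clauses-at π T-π = ⋀-elim (⊨ᵇ⇒Holds (⋀ clauses) (proj₂ (proj₂ (closed π T-π))))

  w-a-1 : A 1 ≡ true
  w-a-1 = ≡-stable do
    ⟨ a-1 ⟩ ∷ _ ← clauses-at w T-w
    pure a-1

  w-o : ∀ k → w k o ≡ odd k
  w-o zero = ≡-stable do
    _ ∷ o-clause ∷ _ ← clauses-at w T-w
    ⟨ ¬o-0 ⟩ , _ ← ∧-elim o-clause
    pure (¬-not ¬o-0)
  w-o (suc k) = ≡-stable do
    _ ∷ o-clause ∷ _ ← clauses-at w T-w
    _ , always ← ∧-elim o-clause
    step ← □-elim always k
    to , from ← ⇔-elim step
    pure (trans (≡-not-from-⇔ (holds ∘ to ∘ ⟨_⟩) (holds ∘ from ∘ ⟨_⟩)) (cong not (w-o k)))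
    where
    ≡-not-from-⇔ : ∀ {x y} → (x ≡ true → ¬ y ≡ true) → (¬ y ≡ true → x ≡ true) → y ≡ not x
    ≡-not-from-⇔ {true} f _ = ¬-not (f refl)
    ≡-not-from-⇔ {false} {true} _ _ = refl
    ≡-not-from-⇔ {false} {false} _ g = contradiction (g λ ()) λ ()

  w-a-odd : ∀ m → odd (2 + m) ≡ true → A (2 + m) ≡ false
  w-a-odd m odd-m = ≡-stable do
    _ ∷ _ ∷ no-a ∷ _ ← clauses-at w T-w
    step ← □-elim (next-elim (next-elim no-a)) m
    imp ← ⇒-elim step
    pure (¬-not (holds (imp ⟨ trans (w-o (2 + m)) odd-m ⟩)))

  w-b : Exactly w b 0
  w-b zero = ≡-stable do
    _ ∷ _ ∷ _ ∷ bc ∷ _ ← clauses-at w T-w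
    ⟨ b-0 ⟩ ∷ _ ← ⋀-elim bc
    pure b-0
  w-b (suc k) = ≡-stable do
    _ ∷ _ ∷ _ ∷ bc ∷ _ ← clauses-at w T-w
    _ ∷ _ ∷ later ∷ [] ← ⋀-elim bc
    step ← □-elim (next-elim later) k
    ⟨ ¬b ⟩ , _ ← ∧-elim step
    pure (¬-not ¬b)

  w-c : Exactly w c 0
  w-c zero = ≡-stable do
    _ ∷ _ ∷ _ ∷ bc ∷ _ ← clauses-at w T-w
    _ ∷ ⟨ c-0 ⟩ ∷ _ ← ⋀-elim bc
    pure c-0
  w-c (suc k) = ≡-stable do
    _ ∷ _ ∷ _ ∷ bc ∷ _ ← clauses-at w T-w
    _ ∷ _ ∷ later ∷ [] ← ⋀-elim bc
    step ← □-elim (next-elim later) k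
    _ , ⟨ ¬c ⟩ ← ∧-elim step
    pure (¬-not ¬c)

  module _ {π} (T-π : T π) where

    next-b : ∀ {n} → Exactly π b n → Exactly (next-of π T-π) b (suc n)
    next-b _ zero = ≡-stable do
      _ ∷ _ ∷ _ ∷ _ ∷ _ ∷ succ ∷ _ ← clauses-at π T-π
      ⟨ ¬b-0 ⟩ ∷ _ ← ⋀-elim succ
      pure (¬-not ¬b-0)
    next-b exact (suc k) = ≡-stable do
      _ ∷ _ ∷ _ ∷ _ ∷ _ ∷ succ ∷ _ ← clauses-at π T-π
      _ ∷ _ ∷ _ ∷ b-shift ∷ _ ← ⋀-elim succ
      step ← □-elim b-shift k
      to , from ← ⇔-elim step
      pure (trans (sym (≡-from-⇔ (pure ∘ holds ∘ to ∘ ⟨_⟩) (pure ∘ holds ∘ from ∘ ⟨_⟩))) (exact k))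

    next-c : ∀ {n} → Exactly π c (n * 2) → Exactly (next-of π T-π) c (suc n * 2)
    next-c _ zero = ≡-stable do
      _ ∷ _ ∷ _ ∷ _ ∷ _ ∷ succ ∷ _ ← clauses-at π T-π
      _ ∷ ⟨ ¬c-0 ⟩ ∷ _ ← ⋀-elim succ
      pure (¬-not ¬c-0)
    next-c _ (suc zero) = ≡-stable do
      _ ∷ _ ∷ _ ∷ _ ∷ _ ∷ succ ∷ _ ← clauses-at π T-π
      _ ∷ _ ∷ ⟨ ¬c-1 ⟩ ∷ _ ← ⋀-elim succ
      pure (¬-not ¬c-1)
    next-c exact (suc (suc k)) = ≡-stable do
      _ ∷ _ ∷ _ ∷ _ ∷ _ ∷ succ ∷ _ ← clauses-at π T-π
      _ ∷ _ ∷ _ ∷ _ ∷ c-shift ∷ _ ← ⋀-elim succ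
      step ← □-elim c-shift k
      to , from ← ⇔-elim step
      pure (trans (sym (≡-from-⇔ (pure ∘ holds ∘ to ∘ ⟨_⟩) (pure ∘ holds ∘ from ∘ ⟨_⟩))) (exact k))

  Family : ℕ → Set
  Family n = ∃ λ t → T t × Exactly t b n × Exactly t c (n * 2)

  family : ∀ n → Family n
  family zero = w , T-w , w-b , w-c
  family (suc n) = let _ , T-t , t-b , t-c = family n
                   in _ , proj₁ (proj₂ (closed _ T-t)) , next-b T-t t-b , next-c T-t {n} t-c

  w-a-*2 : ∀ n → A (n * 2) ≡ A n
  w-a-*2 n with family n
  ... | t , T-t , t-b , t-c = ≡-stable do
    _ ∷ _ ∷ _ ∷ _ ∷ dbl ∷ _ ← clauses-at t T-t
    to , from ← ⇔-elim dbl
    pure (sym (≡-from-⇔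
      (λ a-n → holds <$> ◇-exactly-elim t-c (to (◇-exactly-intro t-b ⟨ a-n ⟩)))
      (λ a-2n → holds <$> ◇-exactly-elim t-b (from (◇-exactly-intro t-c ⟨ a-2n ⟩)))))

  agrees : ∀ v (T-v : T v) → v 0 b ≡ true → ∀ k → v k a ≡ A k
  agrees v T-v b-0 k = ≡-stable do
    _ ∷ _ ∷ _ ∷ _ ∷ _ ∷ _ ∷ agree ∷ [] ← clauses-at v T-v
    imp ← ⇒-elim agree
    step ← □-elim (imp ⟨ b-0 ⟩) k
    to , from ← ⇔-elim step
    pure (≡-from-⇔ (pure ∘ holds ∘ to ∘ ⟨_⟩) (pure ∘ holds ∘ from ∘ ⟨_⟩))

  w-a-scale : ∀ K y → A (2 ^ K * y) ≡ A y
  w-a-scale zero y = cong A (+-identityʳ y)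
  w-a-scale (suc K) y = begin
    A (2 * 2 ^ K * y)   ≡⟨ cong A (trans (*-assoc 2 (2 ^ K) y) (*-comm 2 (2 ^ K * y))) ⟩
    A (2 ^ K * y * 2)   ≡⟨ w-a-*2 (2 ^ K * y) ⟩
    A (2 ^ K * y)       ≡⟨ w-a-scale K y ⟩
    A y                 ∎
    where open ≡-Reasoning

  no-deletion : ∀ {p L} → 1 ≤ p → 1 ≤ L → ¬ T (delete w p L)
  no-deletion {p} {L@(suc L′)} 1≤p _ T-v = contradiction true≡false λ ()
    where
    open ≡-Reasoning
    periodic : ∀ t → p ≤ t → A (t + L) ≡ A t
    periodic t p≤t = trans (cong (λ l → l a) (sym (delete-≥ w p≤t)))
                           (agrees _ T-v (trans (cong (λ l → l b) (delete-< w 1≤p)) (w-b 0)) t)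
    iterate : ∀ m t → p ≤ t → A (t + m * L) ≡ A t
    iterate zero t _ = cong A (+-identityʳ t)
    iterate (suc m) t p≤t = begin
      A (t + (L + m * L))  ≡⟨ cong A (sym (+-assoc t L (m * L))) ⟩
      A (t + L + m * L)    ≡⟨ iterate m (t + L) (≤-trans p≤t (m≤m+n t L)) ⟩
      A (t + L)            ≡⟨ periodic t p≤t ⟩
      A t                  ∎
    arith : ∀ x l → x + x * 2 * l ≡ x * (1 + l * 2)
    arith = solve-∀
    true≡false : true ≡ false
    true≡false = begin
      true                       ≡⟨ sym w-a-1 ⟩
      A 1                        ≡⟨ sym (w-a-scale p 1) ⟩
      A (2 ^ p * 1)              ≡⟨ cong A (*-identityʳ (2 ^ p)) ⟩
      A (2 ^ p)                  ≡⟨ sym (iterate (2 ^ p * 2) (2 ^ p) (<⇒≤ (n<2^n p))) ⟩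
      A (2 ^ p + 2 ^ p * 2 * L)  ≡⟨ cong A (arith (2 ^ p) L) ⟩
      A (2 ^ p * (1 + L * 2))    ≡⟨ w-a-scale p (1 + L * 2) ⟩
      A (1 + L * 2)              ≡⟨ w-a-odd (suc (L′ * 2)) (cong (not ∘ not ∘ not) (odd-*2 L′)) ⟩
      false                      ∎

no-ω-context-free-model : ∀ (T : TraceSet 4) → OmegaContextFree T → ¬ (T ⊨ φ)
no-ω-context-free-model T (P , language) (w , T-w , closed) =
  pumping P (proj₁ (language w) T-w) 1 λ (_ , _ , 1≤p , 1≤L , run) →
    Refutation.no-deletion T w T-w closed 1≤p 1≤L (proj₂ (language _) run)

theorem4 : Σ ℕ λ n → Σ (Sentence n) λ φ →
             Satisfiable φ × (∀ (T : TraceSet n) → OmegaContextFree T → ¬ (T ⊨ φ))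
theorem4 = 4 , φ , φ-satisfiable , no-ω-context-free-model
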